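{- Let $n,r,s$ be positive integers and let $W_n$ be the Horadam quaternions built from the Horadam sequence $w_n=w_n(w_0,w_1;p,q)$. Then $$W_{n+r}W_{n+s}-W_{n}W_{n+r+s}=(-q)^{n}u_{r}\left(U_{1}U_{s}-U_{0}U_{s+1}\right)\left(w_1^2-pw_0w_1-qw_0^2\right).$$
   Context: Let $H$ be the real quaternion algebra with basis $1,i,j,k$ and (non-commutative) multiplication determined by $i^2=j^2=k^2=-1$, $ij=-ji=k$, $jk=-kj=i$, $ki=-ik=j$; real scalars commute with all quaternions. Fix real numbers $p,q$. The Horadam sequence $w_n=w_n(w_0,w_1;p,q)$ has real initial values $w_0,w_1$ and satisfies $w_n=pw_{n-1}+qw_{n-2}$ for $n\ge 2$. Let $u_n=w_n(0,1;p,q)$ (the $(p,q)$-Fibonacci numbers). The Horadam quaternions are $W_n=w_n+w_{n+1}i+w_{n+2}j+w_{n+3}k$, and the $(p,q)$-Fibonacci quaternions are $U_n=u_n+u_{n+1}i+u_{n+2}j+u_{n+3}k$. -}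

module Defs where

open import Level using (_⊔_)
open import Data.Nat using (ℕ; zero; suc)
open import Algebra.Bundles using (CommutativeRing)

-- Quaternions over a commutative ring R (the paper uses R = ℝ), with the
-- multiplication i²=j²=k²=-1, ij=-ji=k, jk=-kj=i, ki=-ik=j.
module Quaternion {c ℓ} (R : CommutativeRing c ℓ) where
  open CommutativeRing R

  record Quat : Set c where
    constructor quat
    field
      re  : Carrier
      ci  : Carrier
      cj  : Carrier
      ck  : Carrier
  open Quat public

  infix 4 _≃_
  _≃_ : Quat → Quat → Set ℓ
  x ≃ y = (re x ≈ re y) × (ci x ≈ ci y) × (cj x ≈ cj y) × (ck x ≈ ck y)
    where open import Data.Product using (_×_)

  infixl 6 _⊕_ _⊖_
  infixl 7 _⊗_ _·_

  _⊕_ : Quat → Quat → Quat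
  quat a b c' d ⊕ quat a' b' c'' d' = quat (a + a') (b + b') (c' + c'') (d + d')

  _⊖_ : Quat → Quat → Quat
  quat a b c' d ⊖ quat a' b' c'' d' = quat (a - a') (b - b') (c' - c'') (d - d')

  _⊗_ : Quat → Quat → Quat
  quat a₁ b₁ c₁ d₁ ⊗ quat a₂ b₂ c₂ d₂ = quat
    (a₁ * a₂ - b₁ * b₂ - c₁ * c₂ - d₁ * d₂)
    (a₁ * b₂ + b₁ * a₂ + c₁ * d₂ - d₁ * c₂)
    (a₁ * c₂ - b₁ * d₂ + c₁ * a₂ + d₁ * b₂)
    (a₁ * d₂ + b₁ * c₂ - c₁ * b₂ + d₁ * a₂)

  _·_ : Carrier → Quat → Quat
  t · quat a b c' d = quat (t * a) (t * b) (t * c') (t * d)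

  pow : Carrier → ℕ → Carrier
  pow x zero    = 1#
  pow x (suc n) = x * pow x n

  horadam : (w₀ w₁ p q : Carrier) → ℕ → Carrier
  horadam w₀ w₁ p q zero          = w₀
  horadam w₀ w₁ p q (suc zero)    = w₁
  horadam w₀ w₁ p q (suc (suc n)) =
    p * horadam w₀ w₁ p q (suc n) + q * horadam w₀ w₁ p q n

  fib : (p q : Carrier) → ℕ → Carrier
  fib p q = horadam 0# 1# p q

  HQ : (w₀ w₁ p q : Carrier) → ℕ → Quat
  HQ w₀ w₁ p q n = quat (w n) (w (suc n)) (w (suc (suc n))) (w (suc (suc (suc n))))
    where w = horadam w₀ w₁ p q

  FQ : (p q : Carrier) → ℕ → Quat
  FQ p q = HQ 0# 1# p q

-- Every solution of w_{k+2} = p w_{k+1} + q w_k satisfies the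
-- addition formula w_{n+k} = u_k w_{n+1} + v_k w_n, where u = w(0,1) and
-- v = w(1,0) are the fundamental solutions.  Hence all four quaternions on
-- the left are determined by the pair (A, B) = (w_n, w_{n+1}) and the numbers
-- u_r, v_r, u_s, v_s (u_{r+s}, v_{r+s} by the addition formula again), and
-- after this substitution the theorem becomes a polynomial identity in eight
-- variables (core-identity), checked componentwise by the ring solver.  The
-- scalar factor is B² - pAB - qA², which gains a factor -q per step
-- (form-horadam), giving (-q)^n (w_1² - p w_0 w_1 - q w_0²).
module Submission where

open import Defs
open import Data.Nat using (ℕ; _+_; _≤_)
open import Algebra.Bundles using (CommutativeRing)

open import Data.Nat using (zero; suc)
import Data.Nat.Properties as ℕₚ
open import Algebra.Bundles using (RawRing)
open import Data.Maybe using (Maybe; just; nothing)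
open import Data.Product using (_,_)
open import Relation.Binary.PropositionalEquality as ≡ using (_≡_)
open import Relation.Nullary using (yes; no)
open import Algebra.Solver.Ring.AlmostCommutativeRing
  using (_-Raw-AlmostCommutative⟶_; fromCommutativeRing)

-- The integers, used as the coefficient ring of the commutative-ring solver
-- (the library provides no homomorphism from its ℤ into an arbitrary ring).
-- Addition and multiplication recurse on the first argument via
-- successor/predecessor, which makes that homomorphism easy to verify.
module IntegerCoefficients where

  data Int : Set where
    pos    : ℕ → Int
    negsuc : ℕ → Int

  sucᵢ predᵢ -ᵢ_ : Int → Int
  sucᵢ (pos n)            = pos (suc n)
  sucᵢ (negsuc zero)      = pos zero
  sucᵢ (negsuc (suc n))   = negsuc n
  predᵢ (pos zero)        = negsuc zero
  predᵢ (pos (suc n))     = pos n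
  predᵢ (negsuc n)        = negsuc (suc n)
  -ᵢ pos zero             = pos zero
  -ᵢ pos (suc n)          = negsuc n
  -ᵢ negsuc n             = pos (suc n)

  _+ᵢ_ _*ᵢ_ : Int → Int → Int
  pos zero         +ᵢ j = j
  pos (suc m)      +ᵢ j = sucᵢ (pos m +ᵢ j)
  negsuc zero      +ᵢ j = predᵢ j
  negsuc (suc m)   +ᵢ j = predᵢ (negsuc m +ᵢ j)
  pos zero         *ᵢ j = pos zero
  pos (suc m)      *ᵢ j = j +ᵢ (pos m *ᵢ j)
  negsuc zero      *ᵢ j = -ᵢ j
  negsuc (suc m)   *ᵢ j = (-ᵢ j) +ᵢ (negsuc m *ᵢ j)

  -- Syntactic equality test; the solver only needs it to be sound.
  _≟ᵢ_ : (i j : Int) → Maybe (i ≡ j)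
  pos m    ≟ᵢ pos n    with m ℕₚ.≟ n
  ... | yes m≡n = just (≡.cong pos m≡n)
  ... | no  _   = nothing
  negsuc m ≟ᵢ negsuc n with m ℕₚ.≟ n
  ... | yes m≡n = just (≡.cong negsuc m≡n)
  ... | no  _   = nothing
  _        ≟ᵢ _        = nothing

  intRawRing : RawRing _ _
  intRawRing = record
    { Carrier = Int ; _≈_ = _≡_ ; _+_ = _+ᵢ_ ; _*_ = _*ᵢ_ ; -_ = -ᵢ_
    ; 0# = pos zero ; 1# = pos 1 }

  module Into {c ℓ} (R : CommutativeRing c ℓ) where
    open CommutativeRing R hiding (zero) renaming (_+_ to _+ᴿ_)
    open import Algebra.Properties.Ring ring using (-0#≈0#; -‿involutive; -‿+-comm; -1*x≈-x)
    open import Algebra.Properties.Monoid.Mult.TCOptimised +-monoid using (_×_; 1+×)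
    open import Relation.Binary.Reasoning.Setoid setoid

    ⟦_⟧ : Int → Carrier
    ⟦ pos n ⟧    = n × 1#
    ⟦ negsuc n ⟧ = - (suc n × 1#)

    ⟦-1-⟧ : ∀ n → - (suc n × 1#) ≈ - 1# +ᴿ - (n × 1#)
    ⟦-1-⟧ n = trans (-‿cong (1+× n 1#)) (sym (-‿+-comm 1# (n × 1#)))

    -x≈1+[-1+-x] : ∀ x → - x ≈ 1# +ᴿ (- 1# +ᴿ - x)
    -x≈1+[-1+-x] x = begin
      - x                      ≈⟨ +-identityˡ (- x) ⟨
      0# +ᴿ - x                ≈⟨ +-congʳ (-‿inverseʳ 1#) ⟨
      (1# +ᴿ - 1#) +ᴿ - x      ≈⟨ +-assoc 1# (- 1#) (- x) ⟩
      1# +ᴿ (- 1# +ᴿ - x)      ∎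

    x≈-1+[1+x] : ∀ x → x ≈ - 1# +ᴿ (1# +ᴿ x)
    x≈-1+[1+x] x = begin
      x                        ≈⟨ +-identityˡ x ⟨
      0# +ᴿ x                  ≈⟨ +-congʳ (-‿inverseˡ 1#) ⟨
      (- 1# +ᴿ 1#) +ᴿ x        ≈⟨ +-assoc (- 1#) 1# x ⟩
      - 1# +ᴿ (1# +ᴿ x)        ∎

    ⟦suc⟧ : ∀ j → ⟦ sucᵢ j ⟧ ≈ 1# +ᴿ ⟦ j ⟧
    ⟦suc⟧ (pos n)          = 1+× n 1#
    ⟦suc⟧ (negsuc zero)    = sym (-‿inverseʳ 1#)
    ⟦suc⟧ (negsuc (suc n)) = trans (-x≈1+[-1+-x] (suc n × 1#)) (+-congˡ (sym (⟦-1-⟧ (suc n))))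

    ⟦pred⟧ : ∀ j → ⟦ predᵢ j ⟧ ≈ - 1# +ᴿ ⟦ j ⟧
    ⟦pred⟧ (pos zero)    = sym (+-identityʳ (- 1#))
    ⟦pred⟧ (pos (suc n)) = trans (x≈-1+[1+x] (n × 1#)) (+-congˡ (sym (1+× n 1#)))
    ⟦pred⟧ (negsuc n)    = ⟦-1-⟧ (suc n)

    ⟦neg⟧ : ∀ j → ⟦ -ᵢ j ⟧ ≈ - ⟦ j ⟧
    ⟦neg⟧ (pos zero)    = sym -0#≈0#
    ⟦neg⟧ (pos (suc n)) = refl
    ⟦neg⟧ (negsuc n)    = sym (-‿involutive (suc n × 1#))

    ⟦neg⟧-as-* : ∀ j → ⟦ -ᵢ j ⟧ ≈ - 1# * ⟦ j ⟧
    ⟦neg⟧-as-* j = trans (⟦neg⟧ j) (sym (-1*x≈-x ⟦ j ⟧))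

    ⟦+⟧ : ∀ i j → ⟦ i +ᵢ j ⟧ ≈ ⟦ i ⟧ +ᴿ ⟦ j ⟧
    ⟦+⟧ (pos zero) j = sym (+-identityˡ ⟦ j ⟧)
    ⟦+⟧ (pos (suc m)) j = begin
      ⟦ sucᵢ (pos m +ᵢ j) ⟧          ≈⟨ ⟦suc⟧ (pos m +ᵢ j) ⟩
      1# +ᴿ ⟦ pos m +ᵢ j ⟧           ≈⟨ +-congˡ (⟦+⟧ (pos m) j) ⟩
      1# +ᴿ (m × 1# +ᴿ ⟦ j ⟧)        ≈⟨ +-assoc 1# (m × 1#) ⟦ j ⟧ ⟨
      (1# +ᴿ m × 1#) +ᴿ ⟦ j ⟧        ≈⟨ +-congʳ (1+× m 1#) ⟨
      suc m × 1# +ᴿ ⟦ j ⟧            ∎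
    ⟦+⟧ (negsuc zero) j = ⟦pred⟧ j
    ⟦+⟧ (negsuc (suc m)) j = begin
      ⟦ predᵢ (negsuc m +ᵢ j) ⟧                 ≈⟨ ⟦pred⟧ (negsuc m +ᵢ j) ⟩
      - 1# +ᴿ ⟦ negsuc m +ᵢ j ⟧                 ≈⟨ +-congˡ (⟦+⟧ (negsuc m) j) ⟩
      - 1# +ᴿ (- (suc m × 1#) +ᴿ ⟦ j ⟧)         ≈⟨ +-assoc (- 1#) (- (suc m × 1#)) ⟦ j ⟧ ⟨
      (- 1# +ᴿ - (suc m × 1#)) +ᴿ ⟦ j ⟧         ≈⟨ +-congʳ (⟦-1-⟧ (suc m)) ⟨
      - (suc (suc m) × 1#) +ᴿ ⟦ j ⟧             ∎

    ⟦*⟧ : ∀ i j → ⟦ i *ᵢ j ⟧ ≈ ⟦ i ⟧ * ⟦ j ⟧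
    ⟦*⟧ (pos zero) j = sym (zeroˡ ⟦ j ⟧)
    ⟦*⟧ (pos (suc m)) j = begin
      ⟦ j +ᵢ (pos m *ᵢ j) ⟧              ≈⟨ ⟦+⟧ j (pos m *ᵢ j) ⟩
      ⟦ j ⟧ +ᴿ ⟦ pos m *ᵢ j ⟧            ≈⟨ +-cong (sym (*-identityˡ ⟦ j ⟧)) (⟦*⟧ (pos m) j) ⟩
      1# * ⟦ j ⟧ +ᴿ m × 1# * ⟦ j ⟧       ≈⟨ distribʳ ⟦ j ⟧ 1# (m × 1#) ⟨
      (1# +ᴿ m × 1#) * ⟦ j ⟧             ≈⟨ *-congʳ (1+× m 1#) ⟨
      suc m × 1# * ⟦ j ⟧                 ∎
    ⟦*⟧ (negsuc zero) j = ⟦neg⟧-as-* j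
    ⟦*⟧ (negsuc (suc m)) j = begin
      ⟦ (-ᵢ j) +ᵢ (negsuc m *ᵢ j) ⟧                 ≈⟨ ⟦+⟧ (-ᵢ j) (negsuc m *ᵢ j) ⟩
      ⟦ -ᵢ j ⟧ +ᴿ ⟦ negsuc m *ᵢ j ⟧                 ≈⟨ +-cong (⟦neg⟧-as-* j) (⟦*⟧ (negsuc m) j) ⟩
      - 1# * ⟦ j ⟧ +ᴿ - (suc m × 1#) * ⟦ j ⟧        ≈⟨ distribʳ ⟦ j ⟧ (- 1#) (- (suc m × 1#)) ⟨
      (- 1# +ᴿ - (suc m × 1#)) * ⟦ j ⟧              ≈⟨ *-congʳ (⟦-1-⟧ (suc m)) ⟨
      - (suc (suc m) × 1#) * ⟦ j ⟧                  ∎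

    homomorphism : intRawRing -Raw-AlmostCommutative⟶ fromCommutativeRing R
    homomorphism = record
      { ⟦_⟧ = ⟦_⟧ ; +-homo = ⟦+⟧ ; *-homo = ⟦*⟧ ; -‿homo = ⟦neg⟧
      ; 0-homo = refl ; 1-homo = refl }

    weaklyDecidable : ∀ i j → Maybe (⟦ i ⟧ ≈ ⟦ j ⟧)
    weaklyDecidable i j with i ≟ᵢ j
    ... | just i≡j = just (reflexive (≡.cong ⟦_⟧ i≡j))
    ... | nothing  = nothing

module HoradamQuaternions {c ℓ} (R : CommutativeRing c ℓ) where
  open CommutativeRing R hiding (zero) renaming (_+_ to _+ᴿ_)
  open Quaternion R
  open IntegerCoefficients using (intRawRing; pos; module Into)
  open Into R using (homomorphism; weaklyDecidable)
  open import Algebra.Solver.Ring intRawRing (fromCommutativeRing R) homomorphism weaklyDecidable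
    using (solve; Polynomial; con) renaming (_:+_ to _⊞_; _:*_ to _⊠_; _:-_ to _⊟_; :-_ to ⊟_)
  open import Relation.Binary.Reasoning.Setoid setoid

  ≃-refl : ∀ {x} → x ≃ x
  ≃-refl = refl , refl , refl , refl

  ≃-trans : ∀ {x y z} → x ≃ y → y ≃ z → x ≃ z
  ≃-trans (a , b , c′ , d) (a′ , b′ , c″ , d′) = trans a a′ , trans b b′ , trans c′ c″ , trans d d′

  -‿cong₂ : ∀ {a a′ b b′} → a ≈ a′ → b ≈ b′ → a - b ≈ a′ - b′
  -‿cong₂ e f = +-cong e (-‿cong f)

  ⊗-cong : ∀ {x x′ y y′} → x ≃ x′ → y ≃ y′ → x ⊗ y ≃ x′ ⊗ y′
  ⊗-cong {quat _ _ _ _} {quat _ _ _ _} {quat _ _ _ _} {quat _ _ _ _}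
         (a₁ , b₁ , c₁ , d₁) (a₂ , b₂ , c₂ , d₂) =
    -‿cong₂ (-‿cong₂ (-‿cong₂ (*-cong a₁ a₂) (*-cong b₁ b₂)) (*-cong c₁ c₂)) (*-cong d₁ d₂) ,
    -‿cong₂ (+-cong (+-cong (*-cong a₁ b₂) (*-cong b₁ a₂)) (*-cong c₁ d₂)) (*-cong d₁ c₂) ,
    +-cong (+-cong (-‿cong₂ (*-cong a₁ c₂) (*-cong b₁ d₂)) (*-cong c₁ a₂)) (*-cong d₁ b₂) ,
    +-cong (-‿cong₂ (+-cong (*-cong a₁ d₂) (*-cong b₁ c₂)) (*-cong c₁ b₂)) (*-cong d₁ a₂)

  ⊖-cong : ∀ {x x′ y y′} → x ≃ x′ → y ≃ y′ → x ⊖ y ≃ x′ ⊖ y′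
  ⊖-cong {quat _ _ _ _} {quat _ _ _ _} {quat _ _ _ _} {quat _ _ _ _}
         (a₁ , b₁ , c₁ , d₁) (a₂ , b₂ , c₂ , d₂) =
    -‿cong₂ a₁ a₂ , -‿cong₂ b₁ b₂ , -‿cong₂ c₁ c₂ , -‿cong₂ d₁ d₂

  ·-cong : ∀ {t t′ x x′} → t ≈ t′ → x ≃ x′ → t · x ≃ t′ · x′
  ·-cong {x = quat _ _ _ _} {quat _ _ _ _} e (a , b , c′ , d) =
    *-cong e a , *-cong e b , *-cong e c′ , *-cong e d

  -- Polynomial shadows of quat₂, shifted, form and the quaternion
  -- operations (mirroring Recurrence below and Defs): a component of an
  -- identity between such quaternion expressions is then a polynomial
  -- identity that the ring solver decides.
  module Syntax {m : ℕ} (p q : Polynomial m) where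
    record Quatₚ : Set where
      constructor quatₚ
      field reₚ ciₚ cjₚ ckₚ : Polynomial m

    infixl 6 _⊖ₚ_
    infixl 7 _⊗ₚ_ _·ₚ_

    _⊗ₚ_ : Quatₚ → Quatₚ → Quatₚ
    quatₚ a₁ b₁ c₁ d₁ ⊗ₚ quatₚ a₂ b₂ c₂ d₂ = quatₚ
      (a₁ ⊠ a₂ ⊟ b₁ ⊠ b₂ ⊟ c₁ ⊠ c₂ ⊟ d₁ ⊠ d₂)
      (a₁ ⊠ b₂ ⊞ b₁ ⊠ a₂ ⊞ c₁ ⊠ d₂ ⊟ d₁ ⊠ c₂)
      (a₁ ⊠ c₂ ⊟ b₁ ⊠ d₂ ⊞ c₁ ⊠ a₂ ⊞ d₁ ⊠ b₂)
      (a₁ ⊠ d₂ ⊞ b₁ ⊠ c₂ ⊟ c₁ ⊠ b₂ ⊞ d₁ ⊠ a₂)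

    _⊖ₚ_ : Quatₚ → Quatₚ → Quatₚ
    quatₚ a b c′ d ⊖ₚ quatₚ a′ b′ c″ d′ = quatₚ (a ⊟ a′) (b ⊟ b′) (c′ ⊟ c″) (d ⊟ d′)

    _·ₚ_ : Polynomial m → Quatₚ → Quatₚ
    t ·ₚ quatₚ a b c′ d = quatₚ (t ⊠ a) (t ⊠ b) (t ⊠ c′) (t ⊠ d)

    quat₂ₚ : Polynomial m → Polynomial m → Quatₚ
    quat₂ₚ A B = quatₚ A B (p ⊠ B ⊞ q ⊠ A) (p ⊠ (p ⊠ B ⊞ q ⊠ A) ⊞ q ⊠ B)

    shiftedₚ : (A B a b : Polynomial m) → Quatₚ
    shiftedₚ A B a b = quat₂ₚ (a ⊠ B ⊞ b ⊠ A) ((p ⊠ a ⊞ b) ⊠ B ⊞ (q ⊠ a) ⊠ A)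

    formₚ : Polynomial m → Polynomial m → Polynomial m
    formₚ A B = B ⊠ B ⊟ p ⊠ A ⊠ B ⊟ q ⊠ A ⊠ A

    coreˡ coreʳ : (A B a b a′ b′ : Polynomial m) → Quatₚ
    coreˡ A B a b a′ b′ =
      shiftedₚ A B a b ⊗ₚ shiftedₚ A B a′ b′
        ⊖ₚ quat₂ₚ A B ⊗ₚ shiftedₚ A B (a ⊠ (p ⊠ a′ ⊞ b′) ⊞ b ⊠ a′) (a ⊠ (q ⊠ a′) ⊞ b ⊠ b′)
    coreʳ A B a b a′ b′ = (a ⊠ formₚ A B) ·ₚ
      (quat₂ₚ one (p ⊠ one ⊞ q ⊠ nought) ⊗ₚ quat₂ₚ a′ a′₁ ⊖ₚ quat₂ₚ nought one ⊗ₚ quat₂ₚ a′₁ (p ⊠ a′₁ ⊞ q ⊠ a′))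
      where
      nought = con (pos 0)
      one  = con (pos 1)
      a′₁  = p ⊠ a′ ⊞ b′

  module Recurrence (p q : Carrier) where

    IsHoradam : (ℕ → Carrier) → Set ℓ
    IsHoradam f = ∀ k → f (suc (suc k)) ≈ p * f (suc k) +ᴿ q * f k

    h : (w₀ w₁ : Carrier) → ℕ → Carrier
    h w₀ w₁ = horadam w₀ w₁ p q

    u v : ℕ → Carrier
    u = h 0# 1#
    v = h 1# 0#

    IsHoradam-unique : ∀ {f g} → IsHoradam f → IsHoradam g →
                       f 0 ≈ g 0 → f 1 ≈ g 1 → ∀ k → f k ≈ g k
    IsHoradam-unique rf rg e₀ e₁ zero          = e₀
    IsHoradam-unique rf rg e₀ e₁ (suc zero)    = e₁
    IsHoradam-unique {f} {g} rf rg e₀ e₁ (suc (suc k)) = begin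
      f (suc (suc k))            ≈⟨ rf k ⟩
      p * f (suc k) +ᴿ q * f k   ≈⟨ +-cong (*-congˡ (IsHoradam-unique rf rg e₀ e₁ (suc k)))
                                           (*-congˡ (IsHoradam-unique rf rg e₀ e₁ k)) ⟩
      p * g (suc k) +ᴿ q * g k   ≈⟨ rg k ⟨
      g (suc (suc k))            ∎

    IsHoradam-combination : ∀ {f g} a b → IsHoradam f → IsHoradam g →
                            IsHoradam (λ k → f k * a +ᴿ g k * b)
    IsHoradam-combination {f} {g} a b rf rg k =
      trans (+-cong (*-congʳ (rf k)) (*-congʳ (rg k)))
            (distribute p q (f (suc k)) (f k) (g (suc k)) (g k) a b)
      where
      distribute = solve 8 (λ p q f₁ f₀ g₁ g₀ a b →
        (p ⊠ f₁ ⊞ q ⊠ f₀) ⊠ a ⊞ (p ⊠ g₁ ⊞ q ⊠ g₀) ⊠ b ,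
        p ⊠ (f₁ ⊠ a ⊞ g₁ ⊠ b) ⊞ q ⊠ (f₀ ⊠ a ⊞ g₀ ⊠ b)) refl

    h-shift : ∀ w₀ w₁ m k → h w₀ w₁ (k + m) ≈ u k * h w₀ w₁ (suc m) +ᴿ v k * h w₀ w₁ m
    h-shift w₀ w₁ m = IsHoradam-unique (λ k → refl)
      (IsHoradam-combination (h w₀ w₁ (suc m)) (h w₀ w₁ m) (λ k → refl) (λ k → refl))
      (solve 2 (λ A B → A , con (pos 0) ⊠ B ⊞ con (pos 1) ⊠ A) refl (h w₀ w₁ m) (h w₀ w₁ (suc m)))
      (solve 2 (λ A B → B , con (pos 1) ⊠ B ⊞ con (pos 0) ⊠ A) refl (h w₀ w₁ m) (h w₀ w₁ (suc m)))

    u-suc : ∀ k → u (suc k) ≈ p * u k +ᴿ v k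
    u-suc k = trans (reflexive (≡.cong u (ℕₚ.+-comm 1 k))) (trans (h-shift 0# 1# 1 k)
      (solve 4 (λ p q a b → a ⊠ (p ⊠ con (pos 1) ⊞ q ⊠ con (pos 0)) ⊞ b ⊠ con (pos 1) , p ⊠ a ⊞ b)
             refl p q (u k) (v k)))

    v-suc : ∀ k → v (suc k) ≈ q * u k
    v-suc k = trans (reflexive (≡.cong v (ℕₚ.+-comm 1 k))) (trans (h-shift 1# 0# 1 k)
      (solve 4 (λ p q a b → a ⊠ (p ⊠ con (pos 0) ⊞ q ⊠ con (pos 1)) ⊞ b ⊠ con (pos 0) , q ⊠ a)
             refl p q (u k) (v k)))

    u-+ : ∀ r s → u (r + s) ≈ u r * (p * u s +ᴿ v s) +ᴿ v r * u s
    u-+ r s = trans (h-shift 0# 1# s r) (+-congʳ (*-congˡ (u-suc s)))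

    v-+ : ∀ r s → v (r + s) ≈ u r * (q * u s) +ᴿ v r * v s
    v-+ r s = trans (h-shift 1# 0# s r) (+-congʳ (*-congˡ (v-suc s)))

    form : Carrier → Carrier → Carrier
    form A B = B * B - p * A * B - q * A * A

    form-step : ∀ A B → form B (p * B +ᴿ q * A) ≈ - q * form A B
    form-step = solve 4 (λ p q A B →
      (p ⊠ B ⊞ q ⊠ A) ⊠ (p ⊠ B ⊞ q ⊠ A) ⊟ p ⊠ B ⊠ (p ⊠ B ⊞ q ⊠ A) ⊟ q ⊠ B ⊠ B ,
      (⊟ q) ⊠ (B ⊠ B ⊟ p ⊠ A ⊠ B ⊟ q ⊠ A ⊠ A)) refl p q

    form-horadam : ∀ w₀ w₁ n → form (h w₀ w₁ n) (h w₀ w₁ (suc n)) ≈ pow (- q) n * form w₀ w₁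
    form-horadam w₀ w₁ zero    = sym (*-identityˡ (form w₀ w₁))
    form-horadam w₀ w₁ (suc n) = begin
      form (h w₀ w₁ (suc n)) (h w₀ w₁ (suc (suc n)))  ≈⟨ form-step (h w₀ w₁ n) (h w₀ w₁ (suc n)) ⟩
      - q * form (h w₀ w₁ n) (h w₀ w₁ (suc n))        ≈⟨ *-congˡ (form-horadam w₀ w₁ n) ⟩
      - q * (pow (- q) n * form w₀ w₁)                ≈⟨ *-assoc (- q) (pow (- q) n) (form w₀ w₁) ⟨
      pow (- q) (suc n) * form w₀ w₁                  ∎

    -- The quaternion with leading components A, B continued by the
    -- recurrence; HQ w₀ w₁ p q n is by definition quat₂ (w n) (w (n+1)).
    quat₂ : Carrier → Carrier → Quat
    quat₂ A B = quat A B (p * B +ᴿ q * A) (p * (p * B +ᴿ q * A) +ᴿ q * B)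

    quat₂-cong : ∀ {A A′ B B′} → A ≈ A′ → B ≈ B′ → quat₂ A B ≃ quat₂ A′ B′
    quat₂-cong eA eB = eA , eB , e₂ , +-cong (*-congˡ e₂) (*-congˡ eB)
      where e₂ = +-cong (*-congˡ eB) (*-congˡ eA)

    -- The quaternion k steps beyond the pair (A, B), where (a, b) = (u_k, v_k).
    shifted : (A B a b : Carrier) → Quat
    shifted A B a b = quat₂ (a * B +ᴿ b * A) ((p * a +ᴿ b) * B +ᴿ (q * a) * A)

    shifted-cong : ∀ {A B a a′ b b′} → a ≈ a′ → b ≈ b′ → shifted A B a b ≃ shifted A B a′ b′
    shifted-cong ea eb = quat₂-cong (+-cong (*-congʳ ea) (*-congʳ eb))
      (+-cong (*-congʳ (+-cong (*-congˡ ea) eb)) (*-congʳ (*-congˡ ea)))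

    HQ-shift : ∀ w₀ w₁ n k →
      HQ w₀ w₁ p q (n + k) ≃ shifted (h w₀ w₁ n) (h w₀ w₁ (suc n)) (u k) (v k)
    HQ-shift w₀ w₁ n k rewrite ℕₚ.+-comm n k =
      quat₂-cong (h-shift w₀ w₁ n k)
                 (trans (h-shift w₀ w₁ n (suc k)) (+-cong (*-congʳ (u-suc k)) (*-congʳ (v-suc k))))

    -- With (a, b) = (u_r, v_r), (a′, b′) = (u_s, v_s) and
    -- (A, B) = (w_n, w_{n+1}), the left side is W_{n+r} W_{n+s} - W_n W_{n+r+s}
    -- and the right side is u_r (B² - pAB - qA²) (U₁ U_s - U₀ U_{s+1}).
    core-identity : ∀ A B a b a′ b′ → let a′₁ = p * a′ +ᴿ b′ in
      shifted A B a b ⊗ shifted A B a′ b′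
        ⊖ quat₂ A B ⊗ shifted A B (a * a′₁ +ᴿ b * a′) (a * (q * a′) +ᴿ b * b′)
      ≃ (a * form A B) ·
          (quat₂ 1# (p * 1# +ᴿ q * 0#) ⊗ quat₂ a′ a′₁ ⊖ quat₂ 0# 1# ⊗ quat₂ a′₁ (p * a′₁ +ᴿ q * a′))
    core-identity A B a b a′ b′ =
      solve 8 (λ p q A B a b a′ b′ → reₚ (coreˡ p q A B a b a′ b′) , reₚ (coreʳ p q A B a b a′ b′))
            refl p q A B a b a′ b′ ,
      solve 8 (λ p q A B a b a′ b′ → ciₚ (coreˡ p q A B a b a′ b′) , ciₚ (coreʳ p q A B a b a′ b′))
            refl p q A B a b a′ b′ ,
      solve 8 (λ p q A B a b a′ b′ → cjₚ (coreˡ p q A B a b a′ b′) , cjₚ (coreʳ p q A B a b a′ b′))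
            refl p q A B a b a′ b′ ,
      solve 8 (λ p q A B a b a′ b′ → ckₚ (coreˡ p q A B a b a′ b′) , ckₚ (coreʳ p q A B a b a′ b′))
            refl p q A B a b a′ b′
      where open Syntax using (coreˡ; coreʳ; module Quatₚ)
            open Quatₚ

  vajda-identity : (w₀ w₁ p q : Carrier) (n r s : ℕ) →
      HQ w₀ w₁ p q (n + r) ⊗ HQ w₀ w₁ p q (n + s) ⊖ HQ w₀ w₁ p q n ⊗ HQ w₀ w₁ p q (n + r + s)
        ≃ (pow (- q) n * fib p q r * (w₁ * w₁ - p * w₀ * w₁ - q * w₀ * w₀))
            · (FQ p q 1 ⊗ FQ p q s ⊖ FQ p q 0 ⊗ FQ p q (s + 1))
  vajda-identity w₀ w₁ p q n r s rewrite ℕₚ.+-comm s 1 =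
    ≃-trans (⊖-cong (⊗-cong (HQ-shift w₀ w₁ n r) (HQ-shift w₀ w₁ n s)) (⊗-cong ≃-refl W[n+r+s]))
   (≃-trans (core-identity A B (u r) (v r) (u s) (v s))
            (·-cong scalar (⊖-cong (⊗-cong ≃-refl (quat₂-cong refl u[s+1]))
                                   (⊗-cong ≃-refl (quat₂-cong u[s+1] (+-congʳ (*-congˡ u[s+1])))))))
    where
    open Recurrence p q
    A = h w₀ w₁ n
    B = h w₀ w₁ (suc n)

    W[n+r+s] : HQ w₀ w₁ p q (n + r + s)
               ≃ shifted A B (u r * (p * u s +ᴿ v s) +ᴿ v r * u s) (u r * (q * u s) +ᴿ v r * v s)
    W[n+r+s] rewrite ℕₚ.+-assoc n r s =
      ≃-trans (HQ-shift w₀ w₁ n (r + s)) (shifted-cong (u-+ r s) (v-+ r s))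

    u[s+1] : p * u s +ᴿ v s ≈ u (suc s)
    u[s+1] = sym (u-suc s)

    scalar : u r * form A B ≈ pow (- q) n * u r * form w₀ w₁
    scalar = trans (*-congˡ (form-horadam w₀ w₁ n))
      (solve 3 (λ a c F → a ⊠ (c ⊠ F) , c ⊠ a ⊠ F) refl (u r) (pow (- q) n) (form w₀ w₁))

theorem2p4 : ∀ {c ℓ} (R : CommutativeRing c ℓ) →
    let open CommutativeRing R renaming (_+_ to _+ᴿ_)
        open Quaternion R
    in (w₀ w₁ p q : Carrier) (n r s : ℕ) → 1 ≤ n → 1 ≤ r → 1 ≤ s →
      HQ w₀ w₁ p q (n + r) ⊗ HQ w₀ w₁ p q (n + s) ⊖ HQ w₀ w₁ p q n ⊗ HQ w₀ w₁ p q (n + r + s)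
        ≃ (pow (- q) n * fib p q r * (w₁ * w₁ - p * w₀ * w₁ - q * w₀ * w₀))
            · (FQ p q 1 ⊗ FQ p q s ⊖ FQ p q 0 ⊗ FQ p q (s + 1))
theorem2p4 R w₀ w₁ p q n r s _ _ _ = HoradamQuaternions.vajda-identity R w₀ w₁ p q n r s
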